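{- Let $\langle A;\cdot,0,\Diamond\rangle$ be a monadic quasi-implication algebra. On $A\setminus\{0\}$ define $x\perp^M_A y$ iff $x\cdot(y\cdot 0)=1$, and $x R^M_A y$ iff $y\cdot\Diamond x=1$. Then for every $x\in A\setminus\{0\}$ and every $z\in R^M_A[R^M_A[\{x\}]^{\perp^M_A}]$, we have $z\cdot\Diamond(\Diamond x\cdot 0)=1$.
   Context: A quasi-implication algebra is a magma $\langle A;\cdot\rangle$ satisfying, for all $x,y,z$: (1) $(x\cdot y)\cdot x=x$; (2) $(x\cdot y)\cdot(x\cdot z)=(y\cdot x)\cdot(y\cdot z)$; (3) $((x\cdot y)\cdot(y\cdot x))\cdot x=((y\cdot x)\cdot(x\cdot y))\cdot y$. In any quasi-implication algebra $x\cdot x=y\cdot y$ for all $x,y$, and $1$ denotes this common element. A bounded quasi-implication algebra is a quasi-implication algebra with a distinguished element $0$ such that $0\cdot x=1$ for all $x$. A monadic quasi-implication algebra is an algebra $\langle A;\cdot,0,\Diamond\rangle$ such that $\langle A;\cdot,0\rangle$ is a bounded quasi-implication algebra and $\Diamond\colon A\to A$ satisfies, for all $x,y$: (a) $\Diamond\Diamond x\cdot\Diamond x=1$ and $x\cdot\Diamond x=1$; (b) $\Diamond(\Diamond x\cdot 0)=\Diamond x\cdot 0$ and $\Diamond 0=0$; (c) $\Diamond(((x\cdot 0)\cdot(y\cdot 0))\cdot x)=((\Diamond x\cdot 0)\cdot(\Diamond y\cdot 0))\cdot\Diamond x$. For a relation $R$ on a set $X$ and $U\subseteq X$, $R[U]=\{y\in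 X: uRy\text{ for some }u\in U\}$; for a relation $\perp$ on $X$, $U^{\perp}=\{y\in X: y\perp u\text{ for all }u\in U\}$. -}

module Defs where

open import Level using (Level; suc; _⊔_)
open import Relation.Binary.PropositionalEquality using (_≡_)
open import Relation.Nullary using (¬_)
open import Data.Product using (Σ; ∃; _×_; _,_; proj₁)

-- A monadic quasi-implication algebra on a carrier type A (equality is ≡).
-- The constant 1 is defined as 0 · 0 (in any QIA, x · x is independent of x).
record MonadicQIA (a : Level) : Set (suc a) where
  infixl 7 _·_
  field
    Carrier : Set a
    _·_ : Carrier → Carrier → Carrier
    𝟘 : Carrier
    ◇ : Carrier → Carrier

  𝟙 : Carrier
  𝟙 = 𝟘 · 𝟘

  field
    qia1 : ∀ x y → (x · y) · x ≡ x
    qia2 : ∀ x y z → (x · y) · (x · z) ≡ (y · x) · (y · z)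
    qia3 : ∀ x y → ((x · y) · (y · x)) · x ≡ ((y · x) · (x · y)) · y
    bounded : ∀ x → 𝟘 · x ≡ 𝟙
    ◇a₁ : ∀ x → ◇ (◇ x) · ◇ x ≡ 𝟙
    ◇a₂ : ∀ x → x · ◇ x ≡ 𝟙
    ◇b₁ : ∀ x → ◇ (◇ x · 𝟘) ≡ ◇ x · 𝟘
    ◇b₂ : ◇ 𝟘 ≡ 𝟘
    ◇c : ∀ x y → ◇ (((x · 𝟘) · (y · 𝟘)) · x) ≡ ((◇ x · 𝟘) · (◇ y · 𝟘)) · ◇ x

module _ {a : Level} (𝔸 : MonadicQIA a) where
  open MonadicQIA 𝔸

  Nonzero : Set a
  Nonzero = Σ Carrier (λ x → ¬ (x ≡ 𝟘))

  _⊥ᴹ_ : Nonzero → Nonzero → Set a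
  x ⊥ᴹ y = proj₁ x · (proj₁ y · 𝟘) ≡ 𝟙

  _Rᴹ_ : Nonzero → Nonzero → Set a
  x Rᴹ y = proj₁ y · ◇ (proj₁ x) ≡ 𝟙

  Subset : Set (suc a)
  Subset = Nonzero → Set a

  image : Subset → Subset
  image U y = ∃ λ u → U u × (u Rᴹ y)

  orth : Subset → Subset
  orth U y = ∀ u → U u → y ⊥ᴹ u

  singleton : Nonzero → Subset
  singleton x y = y ≡ x

module Submission where

-- Write x ≤ y for x · y = 1, x ′ for x · 0 and x ⊔ y for (x ′ · y ′) · x.
-- The relation ≤ is a preorder and ⊔ is commutative and an upper bound,
-- so axiom (c), which says that ◇ preserves ⊔, makes ◇ monotone.
-- Now ◇x is R-related to x, so u ⊥ ◇x gives u ≤ (◇x)′, hence ◇u ≤ ◇((◇x)′);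
-- and z R-related to u means z ≤ ◇u.

open import Defs
open import Level using (Level)
open import Relation.Binary.PropositionalEquality
  using (_≡_; refl; sym; trans; cong; cong₂; subst; module ≡-Reasoning)
open import Relation.Nullary using (¬_)
open import Data.Product using (proj₁; _,_)

module Properties {a : Level} (𝔸 : MonadicQIA a) where
  open MonadicQIA 𝔸
  open ≡-Reasoning

  infix 4 _≤_
  infix 8 _′
  infixl 6 _⊔_

  _≤_ : Carrier → Carrier → Set a
  x ≤ y = x · y ≡ 𝟙

  _′ : Carrier → Carrier
  x ′ = x · 𝟘

  _⊔_ : Carrier → Carrier → Carrier
  x ⊔ y = (x ′ · y ′) · x

  𝟙·𝟘≡𝟘 : 𝟙 · 𝟘 ≡ 𝟘
  𝟙·𝟘≡𝟘 = qia1 𝟘 𝟘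

  𝟙·𝟙≡𝟙 : 𝟙 · 𝟙 ≡ 𝟙
  𝟙·𝟙≡𝟙 = begin
    𝟙 · 𝟙                         ≡⟨ cong (_· 𝟙) (sym (bounded 𝟙)) ⟩
    (𝟘 · 𝟙) · 𝟙                   ≡⟨ cong (λ w → (w · 𝟙) · 𝟙) (sym 𝟙·𝟘≡𝟘) ⟩
    ((𝟙 · 𝟘) · 𝟙) · 𝟙             ≡⟨ cong (λ w → ((𝟙 · 𝟘) · w) · 𝟙) (sym (bounded 𝟙)) ⟩
    ((𝟙 · 𝟘) · (𝟘 · 𝟙)) · 𝟙       ≡⟨ sym (qia3 𝟘 𝟙) ⟩
    ((𝟘 · 𝟙) · (𝟙 · 𝟘)) · 𝟘       ≡⟨ cong (_· 𝟘) (cong₂ _·_ (bounded 𝟙) 𝟙·𝟘≡𝟘) ⟩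
    (𝟙 · 𝟘) · 𝟘                   ≡⟨ cong (_· 𝟘) 𝟙·𝟘≡𝟘 ⟩
    𝟙                             ∎

  x·[x·y]≡x·y : ∀ x y → x · (x · y) ≡ x · y
  x·[x·y]≡x·y x y = trans (cong (_· (x · y)) (sym (qia1 x y))) (qia1 (x · y) x)

  x′≤x·y : ∀ x y → x ′ ≤ x · y
  x′≤x·y x y = trans (qia2 x 𝟘 y) (trans (cong₂ _·_ (bounded x) (bounded y)) 𝟙·𝟙≡𝟙)

  x≤x′·y : ∀ x y → x ≤ x ′ · y
  x≤x′·y x y = begin
    x · (x ′ · y)                 ≡⟨ cong (_· (x ′ · y)) (sym (qia1 x 𝟘)) ⟩
    (x ′ · x) · (x ′ · y)         ≡⟨ qia2 (x ′) x y ⟩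
    (x · x ′) · (x · y)           ≡⟨ cong (_· (x · y)) (x·[x·y]≡x·y x 𝟘) ⟩
    x ′ · (x · y)                 ≡⟨ x′≤x·y x y ⟩
    𝟙                             ∎

  ≤-refl : ∀ x → x ≤ x
  ≤-refl x = trans (cong (x ·_) (sym (qia1 x 𝟘))) (x≤x′·y x x)

  x≤𝟙 : ∀ x → x ≤ 𝟙
  x≤𝟙 x = trans (cong (x ·_) (sym (≤-refl x))) (trans (x·[x·y]≡x·y x x) (≤-refl x))

  ·-identityˡ : ∀ y → 𝟙 · y ≡ y
  ·-identityˡ y = trans (cong (_· y) (sym (≤-refl y))) (qia1 y y)

  ′-involutive : ∀ x → x ′ ′ ≡ x
  ′-involutive x = begin
    x ′ · 𝟘                       ≡⟨ cong (_· 𝟘) (sym (·-identityˡ (x ′))) ⟩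
    (𝟙 · x ′) · 𝟘                 ≡⟨ cong (λ w → (w · x ′) · 𝟘) (sym (bounded x)) ⟩
    ((𝟘 · x) · x ′) · 𝟘           ≡⟨ sym (qia3 x 𝟘) ⟩
    (x ′ · (𝟘 · x)) · x           ≡⟨ cong (λ w → (x ′ · w) · x) (bounded x) ⟩
    (x ′ · 𝟙) · x                 ≡⟨ cong (_· x) (x≤𝟙 (x ′)) ⟩
    𝟙 · x                         ≡⟨ ·-identityˡ x ⟩
    x                             ∎

  x≤y⇒x·z≡[y·x]·[y·z] : ∀ {x y} z → x ≤ y → x · z ≡ (y · x) · (y · z)
  x≤y⇒x·z≡[y·x]·[y·z] {x} {y} z x≤y = begin
    x · z                         ≡⟨ sym (·-identityˡ (x · z)) ⟩
    𝟙 · (x · z)                   ≡⟨ cong (_· (x · z)) (sym x≤y) ⟩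
    (x · y) · (x · z)             ≡⟨ qia2 x y z ⟩
    (y · x) · (y · z)             ∎

  ≤-trans : ∀ {x y z} → x ≤ y → y ≤ z → x ≤ z
  ≤-trans {x} {y} {z} x≤y y≤z = begin
    x · z                         ≡⟨ x≤y⇒x·z≡[y·x]·[y·z] z x≤y ⟩
    (y · x) · (y · z)             ≡⟨ cong ((y · x) ·_) y≤z ⟩
    (y · x) · 𝟙                   ≡⟨ x≤𝟙 (y · x) ⟩
    𝟙                             ∎

  x≤y⇒x≤y·x : ∀ {x y} → x ≤ y → x ≤ y · x
  x≤y⇒x≤y·x {x} {y} x≤y = begin
    x · (y · x)                   ≡⟨ sym (·-identityˡ _) ⟩
    𝟙 · (x · (y · x))             ≡⟨ cong (_· (x · (y · x))) (sym x≤y) ⟩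
    (x · y) · (x · (y · x))       ≡⟨ sym (qia2 y x (y · x)) ⟩
    (y · x) · (y · (y · x))       ≡⟨ cong ((y · x) ·_) (x·[x·y]≡x·y y x) ⟩
    (y · x) · (y · x)             ≡⟨ ≤-refl (y · x) ⟩
    𝟙                             ∎

  ⊔-comm : ∀ x y → x ⊔ y ≡ y ⊔ x
  ⊔-comm x y = begin
    (x ′ · y ′) · x               ≡⟨ cong ((x ′ · y ′) ·_) (sym (′-involutive x)) ⟩
    (x ′ · y ′) · (x ′ · 𝟘)       ≡⟨ qia2 (x ′) (y ′) 𝟘 ⟩
    (y ′ · x ′) · (y ′ · 𝟘)       ≡⟨ cong ((y ′ · x ′) ·_) (′-involutive y) ⟩
    (y ′ · x ′) · y               ∎

  y≤x⊔y : ∀ x y → y ≤ x ⊔ y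
  y≤x⊔y x y = subst (y ≤_) (⊔-comm y x) (x≤y⇒x≤y·x (x≤x′·y y (x ′)))

  x≤y⇒y⊔x≡y : ∀ {x y} → x ≤ y → y ⊔ x ≡ y
  x≤y⇒y⊔x≡y {x} {y} x≤y = trans (cong (_· y) y′≤x′) (·-identityˡ y)
    where
    y′≤x′ : y ′ ≤ x ′
    y′≤x′ = trans (cong (y ′ ·_) (x≤y⇒x·z≡[y·x]·[y·z] 𝟘 x≤y)) (x≤y⇒x≤y·x (x′≤x·y y x))

  ◇-mono : ∀ {x y} → x ≤ y → ◇ x ≤ ◇ y
  ◇-mono {x} {y} x≤y =
    subst (◇ x ≤_) (trans (sym (◇c y x)) (cong ◇ (x≤y⇒y⊔x≡y x≤y))) (y≤x⊔y (◇ y) (◇ x))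

  x≤𝟘⇒x≡𝟘 : ∀ {x} → x ≤ 𝟘 → x ≡ 𝟘
  x≤𝟘⇒x≡𝟘 {x} x≤𝟘 = trans (sym (′-involutive x)) (trans (cong (_· 𝟘) x≤𝟘) 𝟙·𝟘≡𝟘)

  ◇-nonzero : ∀ {x} → ¬ x ≡ 𝟘 → ¬ ◇ x ≡ 𝟘
  ◇-nonzero {x} x≢𝟘 ◇x≡𝟘 = x≢𝟘 (x≤𝟘⇒x≡𝟘 (subst (x ≤_) ◇x≡𝟘 (◇a₂ x)))

lemma5p6 : {a : Level} (𝔸 : MonadicQIA a) (x z : Nonzero 𝔸) →
    image 𝔸 (orth 𝔸 (image 𝔸 (singleton 𝔸 x))) z →
    MonadicQIA._·_ 𝔸 (proj₁ z) (MonadicQIA.◇ 𝔸 (MonadicQIA._·_ 𝔸 (MonadicQIA.◇ 𝔸 (proj₁ x)) (MonadicQIA.𝟘 𝔸))) ≡ MonadicQIA.𝟙 𝔸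
lemma5p6 𝔸 x@(x₀ , x₀≢𝟘) z (u , u∈[Rx]⊥ , uRz) = ≤-trans uRz (◇-mono u≤[◇x]′)
  where
  open MonadicQIA 𝔸
  open Properties 𝔸

  ◇x : Nonzero 𝔸
  ◇x = ◇ x₀ , ◇-nonzero x₀≢𝟘

  u≤[◇x]′ : proj₁ u ≤ ◇ x₀ ′
  u≤[◇x]′ = u∈[Rx]⊥ ◇x (x , refl , ≤-refl (◇ x₀))
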